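{- Let $G$ be a graph on a vertex set $V$ with $|V|=n$ and $m=\beta n^2$ edges, where $\beta>0$. Let $H$ be a triangle-free spanning subgraph of $G$ with at least $0.248m$ edges. Then there exist disjoint sets $A,B\subseteq V$, each an independent set in $H$, such that the set $F^*$ of edges of $H$ with one endpoint in $A$ and the other in $B$ satisfies $|F^*| \ge \beta^2 m/500$, and there exist vertices $u,w\in V$ such that $u$ is adjacent in $H$ to every vertex of $A$ and $w$ is adjacent in $H$ to every vertex of $B$.
   Context: All graphs are finite, simple and undirected. A spanning subgraph of $G$ is a subgraph with the same vertex set. -}

module Defs where

open import Data.Nat using (ℕ; _+_; _<?_)
open import Data.Bool using (Bool; true; false; if_then_else_)
open import Data.Fin using (Fin; toℕ)
open import Data.List using (List; map; allFin)
open import Data.Nat.ListAction using (sum)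
open import Relation.Nullary using (does)
open import Relation.Binary.PropositionalEquality using (_≡_)
open import Data.Empty using (⊥)

record Graph (n : ℕ) : Set where
  field
    adj   : Fin n → Fin n → Bool
    sym   : ∀ x y → adj x y ≡ adj y x
    irrefl : ∀ x → adj x x ≡ false
open Graph public

countPairs : ∀ {n} → (Fin n → Fin n → Bool) → ℕ
countPairs {n} P =
  sum (map (λ i → sum (map (λ j → if P i j then 1 else 0) (allFin n))) (allFin n))

edgeCount : ∀ {n} → Graph n → ℕ
edgeCount G = countPairs (λ i j → if does (toℕ i <? toℕ j) then adj G i j else false)

SpanningSubgraph : ∀ {n} → Graph n → Graph n → Set
SpanningSubgraph H G = ∀ x y → adj H x y ≡ true → adj G x y ≡ true

TriangleFree : ∀ {n} → Graph n → Set
TriangleFree H = ∀ x y z → adj H x y ≡ true → adj H y z ≡ true → adj H x z ≡ true → ⊥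

VSet : ℕ → Set
VSet n = Fin n → Bool

Independent : ∀ {n} → Graph n → VSet n → Set
Independent H A = ∀ x y → A x ≡ true → A y ≡ true → adj H x y ≡ false

Disjoint : ∀ {n} → VSet n → VSet n → Set
Disjoint A B = ∀ x → A x ≡ true → B x ≡ true → ⊥

-- |F*|: edges of H with one endpoint in A and the other in B.
-- For disjoint A, B each such edge corresponds to exactly one ordered pair (a , b)
-- with a ∈ A, b ∈ B.
crossEdges : ∀ {n} → Graph n → VSet n → VSet n → ℕ
crossEdges H A B = countPairs (λ a b → if A a then (if B b then adj H a b else false) else false)

AdjToAll : ∀ {n} → Graph n → Fin n → VSet n → Set
AdjToAll H u A = ∀ a → A a ≡ true → adj H u a ≡ true

-- Write e(x,y) ∈ {0,1} for adjacency in H and d for the degree. Cauchy–Schwarz,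
-- applied first to the degrees and then to the numbers of walks of length two,
-- shows that the number C₄ of closed walks of length four satisfies
-- (Σ d)⁴ ≤ n⁴ · C₄. Since C₄ = Σ_{u,w} e(u,w) · e(N(u),N(w)), some edge uw of H
-- has (Σ d)³ ≤ n⁴ · e(N(u),N(w)). As H is triangle-free, the neighbourhoods N(u)
-- and N(w) of an edge are disjoint independent sets, and Σ d ≥ e(H) ≥ 0.248 e(G)
-- turns the bound into e(G)³ ≤ 500 n⁴ · e(N(u),N(w)).
module Submission where

open import Data.Bool using (Bool; true; false; if_then_else_)
open import Data.Empty using (⊥-elim)
open import Data.Fin as Fin using (Fin; toℕ)
open import Data.List using (List; map; allFin; tabulate; cartesianProduct)
open import Data.List.Extrema.Nat using (argmax; f[xs]≤f[argmax])
open import Data.List.Membership.Propositional.Properties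
  using (∈-allFin; ∈-cartesianProduct⁺)
open import Data.List.Properties using (map-tabulate)
open import Data.List.Relation.Unary.All using (lookup)
import Data.Nat.ListAction as List
open import Data.Nat using (ℕ; zero; suc; _+_; _*_; _^_; _≤_; _<_; _<?_; z≤n; >-nonZero)
open import Data.Nat.Properties
open import Data.Nat.Tactic.RingSolver using (solve-∀)
open import Data.Product using (Σ; _×_; _,_; proj₁; proj₂; uncurry)
open import Data.Sum using (inj₁; inj₂)
open import Relation.Binary.PropositionalEquality
open import Relation.Nullary using (does)
open import Algebra.Properties.Semiring.Sum +-*-semiring
  using (sum; sum-syntax; ∑-comm; ∑-distrib-+; *-distribˡ-sum; *-distribʳ-sum; sum-cong-≗)

open import Defs renaming (sym to adj-sym)

sum-tabulate : ∀ {n} (f : Fin n → ℕ) → List.sum (tabulate f) ≡ sum f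
sum-tabulate {zero}  f = refl
sum-tabulate {suc n} f = cong (f Fin.zero +_) (sum-tabulate (λ i → f (Fin.suc i)))

sum-map-allFin : ∀ {n} (f : Fin n → ℕ) → List.sum (map f (allFin n)) ≡ sum f
sum-map-allFin f = trans (cong List.sum (map-tabulate (λ i → i) f)) (sum-tabulate f)

∑-mono-≤ : ∀ {n} {f g : Fin n → ℕ} → (∀ i → f i ≤ g i) → sum f ≤ sum g
∑-mono-≤ {zero}  f≤g = z≤n
∑-mono-≤ {suc n} f≤g = +-mono-≤ (f≤g Fin.zero) (∑-mono-≤ (λ i → f≤g (Fin.suc i)))

∑-const : ∀ n c → ∑[ i < n ] c ≡ n * c
∑-const zero    c = refl
∑-const (suc n) c = cong (c +_) (∑-const n c)

∑-mul-∑ : ∀ {m n} (f : Fin m → ℕ) (g : Fin n → ℕ) →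
          ∑[ i < m ] ∑[ j < n ] (f i * g j) ≡ sum f * sum g
∑-mul-∑ f g = trans (sum-cong-≗ (λ i → sym (*-distribˡ-sum (f i) g)))
                    (sym (*-distribʳ-sum (sum g) f))

≤⇒2*m*n≤m*m+n*n : ∀ {m n} → m ≤ n → 2 * (m * n) ≤ m * m + n * n
≤⇒2*m*n≤m*m+n*n {m} m≤n with k , refl ← m≤n⇒∃[o]m+o≡n m≤n =
  subst (2 * (m * (m + k)) ≤_) (square-gap m k) (m≤m+n _ (k * k))
  where
  square-gap : ∀ m k → 2 * (m * (m + k)) + k * k ≡ m * m + (m + k) * (m + k)
  square-gap = solve-∀

2*m*n≤m*m+n*n : ∀ m n → 2 * (m * n) ≤ m * m + n * n
2*m*n≤m*m+n*n m n with ≤-total m n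
... | inj₁ m≤n = ≤⇒2*m*n≤m*m+n*n m≤n
... | inj₂ n≤m = subst₂ _≤_ (cong (2 *_) (*-comm n m)) (+-comm (n * n) (m * m))
                   (≤⇒2*m*n≤m*m+n*n n≤m)

cauchy-schwarz : ∀ {n} (f : Fin n → ℕ) → sum f * sum f ≤ n * ∑[ i < n ] (f i * f i)
cauchy-schwarz {n} f = *-cancelˡ-≤ 2 (begin
  2 * (sum f * sum f)                             ≡⟨ cong (2 *_) (sym (∑-mul-∑ f f)) ⟩
  2 * ∑[ i < n ] ∑[ j < n ] (f i * f j)           ≡⟨ *-distribˡ-sum 2 (λ i → ∑[ j < n ] (f i * f j)) ⟩
  ∑[ i < n ] (2 * ∑[ j < n ] (f i * f j))         ≡⟨ sum-cong-≗ (λ i → *-distribˡ-sum 2 (λ j → f i * f j)) ⟩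
  ∑[ i < n ] ∑[ j < n ] (2 * (f i * f j))         ≤⟨ ∑-mono-≤ (λ i → ∑-mono-≤ (λ j → 2*m*n≤m*m+n*n (f i) (f j))) ⟩
  ∑[ i < n ] ∑[ j < n ] (sq i + sq j)             ≡⟨ sum-cong-≗ (λ i → ∑-distrib-+ (λ _ → sq i) sq) ⟩
  ∑[ i < n ] (∑[ j < n ] sq i + Q)                ≡⟨ ∑-distrib-+ (λ i → ∑[ j < n ] sq i) (λ _ → Q) ⟩
  ∑[ i < n ] ∑[ j < n ] sq i + ∑[ i < n ] Q       ≡⟨ cong (_+ ∑[ i < n ] Q) (∑-comm {n} {n} (λ i _ → sq i)) ⟩
  ∑[ j < n ] Q + ∑[ i < n ] Q                     ≡⟨ cong₂ _+_ (∑-const n Q) (∑-const n Q) ⟩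
  n * Q + n * Q                                   ≡⟨ cong (n * Q +_) (sym (+-identityʳ (n * Q))) ⟩
  2 * (n * Q)                                     ∎)
  where
  open ≤-Reasoning
  sq : Fin n → ℕ
  sq i = f i * f i
  Q : ℕ
  Q = sum sq

cauchy-schwarz₂ : ∀ {m n} (f : Fin m → Fin n → ℕ) →
  let S = ∑[ i < m ] ∑[ j < n ] f i j in
  S * S ≤ m * (n * ∑[ i < m ] ∑[ j < n ] (f i j * f i j))
cauchy-schwarz₂ {m} {n} f = begin
  _                                                    ≤⟨ cauchy-schwarz (λ i → sum (f i)) ⟩
  m * ∑[ i < m ] (sum (f i) * sum (f i))               ≤⟨ *-monoʳ-≤ m (∑-mono-≤ (λ i → cauchy-schwarz (f i))) ⟩
  m * ∑[ i < m ] (n * ∑[ j < n ] (f i j * f i j))      ≡⟨ cong (m *_) (sym (*-distribˡ-sum n (λ i → ∑[ j < n ] (f i j * f i j)))) ⟩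
  m * (n * ∑[ i < m ] ∑[ j < n ] (f i j * f i j))      ∎
  where open ≤-Reasoning

0<∑⇒Fin : ∀ {n} (f : Fin n → ℕ) → 0 < sum f → Fin n
0<∑⇒Fin {zero}  f ()
0<∑⇒Fin {suc n} f _  = Fin.zero

argmax₂ : ∀ {n} (f : Fin n → Fin n → ℕ) → Fin n →
          Σ (Fin n) λ u → Σ (Fin n) λ w → ∀ x y → f x y ≤ f u w
argmax₂ {n} f v = u , w , λ x y →
  lookup (f[xs]≤f[argmax] (v , v) pairs) (∈-cartesianProduct⁺ (∈-allFin x) (∈-allFin y))
  where
  pairs : List (Fin n × Fin n)
  pairs = cartesianProduct (allFin n) (allFin n)
  u w : Fin n
  u = proj₁ (argmax (uncurry f) (v , v) pairs)
  w = proj₂ (argmax (uncurry f) (v , v) pairs)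

𝟙 : Bool → ℕ
𝟙 b = if b then 1 else 0

countPairs-∑ : ∀ {n} (P : Fin n → Fin n → Bool) →
               countPairs P ≡ ∑[ i < n ] ∑[ j < n ] 𝟙 (P i j)
countPairs-∑ {n} P = trans (sum-map-allFin (λ i → List.sum (map (λ j → 𝟙 (P i j)) (allFin n))))
                           (sum-cong-≗ (λ i → sum-map-allFin (λ j → 𝟙 (P i j))))

module Walks {n} (H : Graph n) where

  e : Fin n → Fin n → ℕ
  e x y = 𝟙 (adj H x y)

  degree : Fin n → ℕ
  degree x = ∑[ y < n ] e x y

  degreeSum : ℕ
  degreeSum = ∑[ x < n ] degree x

  walks₂ : Fin n → Fin n → ℕ
  walks₂ u y = ∑[ x < n ] (e u x * e x y)

  neighbourhoodEdges : Fin n → Fin n → ℕ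
  neighbourhoodEdges u w = ∑[ x < n ] ∑[ y < n ] (e u x * (e w y * e x y))

  closedWalks₄ : ℕ
  closedWalks₄ = ∑[ u < n ] ∑[ w < n ] (e u w * neighbourhoodEdges u w)

  edgeCount≤degreeSum : edgeCount H ≤ degreeSum
  edgeCount≤degreeSum = subst (_≤ degreeSum) (sym (countPairs-∑ below))
    (∑-mono-≤ (λ i → ∑-mono-≤ (λ j → 𝟙-if≤ (does (toℕ i <? toℕ j)) (adj H i j))))
    where
    below : Fin n → Fin n → Bool
    below i j = if does (toℕ i <? toℕ j) then adj H i j else false
    𝟙-if≤ : ∀ c b → 𝟙 (if c then b else false) ≤ 𝟙 b
    𝟙-if≤ true  b = ≤-refl
    𝟙-if≤ false b = z≤n

  crossEdges-neighbourhoods : ∀ u w → crossEdges H (adj H u) (adj H w) ≡ neighbourhoodEdges u w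
  crossEdges-neighbourhoods u w = trans (countPairs-∑ between)
    (sum-cong-≗ (λ x → sum-cong-≗ (λ y → 𝟙-∧ (adj H u x) (adj H w y) (adj H x y))))
    where
    between : Fin n → Fin n → Bool
    between x y = if adj H u x then (if adj H w y then adj H x y else false) else false
    𝟙-∧ : ∀ a b c → 𝟙 (if a then (if b then c else false) else false) ≡ 𝟙 a * (𝟙 b * 𝟙 c)
    𝟙-∧ true  true  true  = refl
    𝟙-∧ true  true  false = refl
    𝟙-∧ true  false c     = refl
    𝟙-∧ false b     c     = refl

  ∑degree²≡∑walks₂ : ∑[ x < n ] (degree x * degree x) ≡ ∑[ u < n ] ∑[ y < n ] walks₂ u y
  ∑degree²≡∑walks₂ = begin
    ∑[ x < n ] (degree x * degree x)                     ≡⟨ sum-cong-≗ (λ x → cong (_* degree x) (sum-cong-≗ (λ u → cong 𝟙 (adj-sym H x u)))) ⟩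
    ∑[ x < n ] (∑[ u < n ] e u x * degree x)             ≡⟨ sum-cong-≗ (λ x → sym (∑-mul-∑ (λ u → e u x) (e x))) ⟩
    ∑[ x < n ] ∑[ u < n ] ∑[ y < n ] (e u x * e x y)     ≡⟨ ∑-comm {n} {n} (λ x u → ∑[ y < n ] (e u x * e x y)) ⟩
    ∑[ u < n ] ∑[ x < n ] ∑[ y < n ] (e u x * e x y)     ≡⟨ sum-cong-≗ (λ u → ∑-comm {n} {n} (λ x y → e u x * e x y)) ⟩
    ∑[ u < n ] ∑[ y < n ] walks₂ u y                     ∎
    where open ≡-Reasoning

  closedWalks₄≡∑walks₂² : closedWalks₄ ≡ ∑[ u < n ] ∑[ y < n ] (walks₂ u y * walks₂ u y)
  closedWalks₄≡∑walks₂² = sum-cong-≗ fixing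
    where
    open ≡-Reasoning
    rearrange : ∀ a b c d → a * (b * (c * d)) ≡ (b * d) * (a * c)
    rearrange = solve-∀
    fixing : ∀ u → ∑[ w < n ] (e u w * neighbourhoodEdges u w) ≡ ∑[ y < n ] (walks₂ u y * walks₂ u y)
    fixing u = begin
      ∑[ w < n ] (e u w * neighbourhoodEdges u w)
        ≡⟨ sum-cong-≗ (λ w → trans (*-distribˡ-sum (e u w) (λ x → ∑[ y < n ] (e u x * (e w y * e x y))))
                                     (sum-cong-≗ (λ x → *-distribˡ-sum (e u w) (λ y → e u x * (e w y * e x y))))) ⟩
      ∑[ w < n ] ∑[ x < n ] ∑[ y < n ] t w x y  ≡⟨ ∑-comm (λ w x → ∑[ y < n ] t w x y) ⟩
      ∑[ x < n ] ∑[ w < n ] ∑[ y < n ] t w x y  ≡⟨ sum-cong-≗ (λ x → ∑-comm (λ w y → t w x y)) ⟩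
      ∑[ x < n ] ∑[ y < n ] ∑[ w < n ] t w x y  ≡⟨ ∑-comm (λ x y → ∑[ w < n ] t w x y) ⟩
      ∑[ y < n ] ∑[ x < n ] ∑[ w < n ] t w x y
        ≡⟨ sum-cong-≗ (λ y → sum-cong-≗ (λ x → sum-cong-≗ (λ w → rearrange (e u w) (e u x) (e w y) (e x y)))) ⟩
      ∑[ y < n ] ∑[ x < n ] ∑[ w < n ] ((e u x * e x y) * (e u w * e w y))
        ≡⟨ sum-cong-≗ (λ y → ∑-mul-∑ (λ x → e u x * e x y) (λ w → e u w * e w y)) ⟩
      ∑[ y < n ] (walks₂ u y * walks₂ u y)
        ∎
      where
      t : Fin n → Fin n → Fin n → ℕ
      t w x y = e u w * (e u x * (e w y * e x y))

  degreeSum⁴≤n⁴*closedWalks₄ : degreeSum ^ 4 ≤ n ^ 4 * closedWalks₄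
  degreeSum⁴≤n⁴*closedWalks₄ = begin
    degreeSum ^ 4                             ≡⟨ square-square degreeSum ⟩
    (degreeSum * degreeSum) * (degreeSum * degreeSum)
                                              ≤⟨ *-mono-≤ (cauchy-schwarz degree) (cauchy-schwarz degree) ⟩
    (n * D) * (n * D)                         ≡⟨ interchange n D ⟩
    (n * n) * (D * D)                         ≤⟨ *-monoʳ-≤ (n * n) D²≤n²C₄ ⟩
    (n * n) * (n * (n * closedWalks₄))        ≡⟨ fourth-power n closedWalks₄ ⟩
    n ^ 4 * closedWalks₄                      ∎
    where
    open ≤-Reasoning
    D : ℕ
    D = ∑[ x < n ] (degree x * degree x)
    D²≤n²C₄ : D * D ≤ n * (n * closedWalks₄)
    D²≤n²C₄ = subst₂ (λ S C → S * S ≤ n * (n * C)) (sym ∑degree²≡∑walks₂) (sym closedWalks₄≡∑walks₂²)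
                     (cauchy-schwarz₂ walks₂)
    square-square : ∀ a → a * (a * (a * (a * 1))) ≡ (a * a) * (a * a)
    square-square = solve-∀
    interchange : ∀ a b → (a * b) * (a * b) ≡ (a * a) * (b * b)
    interchange = solve-∀
    fourth-power : ∀ a b → (a * a) * (a * (a * b)) ≡ a * (a * (a * (a * 1))) * b
    fourth-power = solve-∀

  closedWalks₄≤degreeSum*bound : ∀ M → (∀ u w → adj H u w ≡ true → neighbourhoodEdges u w ≤ M) →
                                 closedWalks₄ ≤ degreeSum * M
  closedWalks₄≤degreeSum*bound M bounded = begin
    closedWalks₄                    ≤⟨ ∑-mono-≤ (λ u → ∑-mono-≤ (termwise u)) ⟩
    ∑[ u < n ] ∑[ w < n ] (e u w * M) ≡⟨ sum-cong-≗ (λ u → sym (*-distribʳ-sum M (e u))) ⟩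
    ∑[ u < n ] (degree u * M)       ≡⟨ sym (*-distribʳ-sum M degree) ⟩
    degreeSum * M                   ∎
    where
    open ≤-Reasoning
    termwise : ∀ u w → 𝟙 (adj H u w) * neighbourhoodEdges u w ≤ 𝟙 (adj H u w) * M
    termwise u w with adj H u w in uw
    ... | true  = *-monoʳ-≤ 1 (bounded u w uw)
    ... | false = z≤n

  dense-neighbourhood-edge : 0 < degreeSum →
    Σ (Fin n) λ u → Σ (Fin n) λ w → adj H u w ≡ true × degreeSum ^ 3 ≤ n ^ 4 * neighbourhoodEdges u w
  dense-neighbourhood-edge 0<E = u , w , uw∈H , subst (λ c → degreeSum ^ 3 ≤ n ^ 4 * c) (on-edge uw∈H) E³≤n⁴g
    where
    g : Fin n → Fin n → ℕ
    g u w = e u w * neighbourhoodEdges u w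
    on-edge : ∀ {x y} → adj H x y ≡ true → g x y ≡ neighbourhoodEdges x y
    on-edge {x} {y} xy = trans (cong (λ b → 𝟙 b * neighbourhoodEdges x y) xy) (*-identityˡ _)
    -- Maximising over all pairs needs no edge in advance; the maximiser is an
    -- edge because the bound E³≤n⁴g makes g positive there.
    maximiser : Σ (Fin n) λ u → Σ (Fin n) λ w → ∀ x y → g x y ≤ g u w
    maximiser = argmax₂ g (0<∑⇒Fin degree 0<E)
    u w : Fin n
    u = proj₁ maximiser
    w = proj₁ (proj₂ maximiser)
    E³≤n⁴g : degreeSum ^ 3 ≤ n ^ 4 * g u w
    E³≤n⁴g = *-cancelˡ-≤ degreeSum {{>-nonZero 0<E}} (begin
      degreeSum ^ 4                     ≤⟨ degreeSum⁴≤n⁴*closedWalks₄ ⟩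
      n ^ 4 * closedWalks₄              ≤⟨ *-monoʳ-≤ (n ^ 4) (closedWalks₄≤degreeSum*bound (g u w) edges≤max) ⟩
      n ^ 4 * (degreeSum * g u w)       ≡⟨ *-comm-middle (n ^ 4) degreeSum (g u w) ⟩
      degreeSum * (n ^ 4 * g u w)       ∎)
      where
      open ≤-Reasoning
      edges≤max : ∀ x y → adj H x y ≡ true → neighbourhoodEdges x y ≤ g u w
      edges≤max x y xy = subst (_≤ g u w) (on-edge xy) (proj₂ (proj₂ maximiser) x y)
      *-comm-middle : ∀ a b c → a * (b * c) ≡ b * (a * c)
      *-comm-middle = solve-∀
    uw∈H : adj H u w ≡ true
    uw∈H with adj H u w in uw
    ... | true  = refl
    ... | false = ⊥-elim (<-irrefl (sym (*-zeroʳ (n ^ 4)))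
                    (<-≤-trans (m^n>0 degreeSum {{>-nonZero 0<E}} 3)
                      (subst (λ b → degreeSum ^ 3 ≤ n ^ 4 * (𝟙 b * neighbourhoodEdges u w)) uw E³≤n⁴g)))

neighbourhood-independent : ∀ {n} (H : Graph n) → TriangleFree H → ∀ u → Independent H (adj H u)
neighbourhood-independent H triangle-free u x y ux uy with adj H x y in xy
... | true  = ⊥-elim (triangle-free u x y ux xy uy)
... | false = refl

edge-neighbourhoods-disjoint : ∀ {n} (H : Graph n) → TriangleFree H →
                               ∀ {u w} → adj H u w ≡ true → Disjoint (adj H u) (adj H w)
edge-neighbourhoods-disjoint H triangle-free {u} {w} uw x ux wx = triangle-free u w x uw wx ux

248*m≤1000*h⇒m≤5*h : ∀ {m h} → 248 * m ≤ 1000 * h → m ≤ 5 * h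
248*m≤1000*h⇒m≤5*h {m} {h} 248m≤1000h = *-cancelˡ-≤ 1000 (begin
  1000 * m         ≤⟨ *-monoˡ-≤ m (m≤m+n 1000 240) ⟩
  1240 * m         ≡⟨ *-assoc 5 248 m ⟩
  5 * (248 * m)    ≤⟨ *-monoʳ-≤ 5 248m≤1000h ⟩
  5 * (1000 * h)   ≡⟨ *-comm-middle 5 1000 h ⟩
  1000 * (5 * h)   ∎)
  where
  open ≤-Reasoning
  *-comm-middle : ∀ a b c → a * (b * c) ≡ b * (a * c)
  *-comm-middle = solve-∀

m≤5*e⇒m³≤500*x : ∀ {m e x} → m ≤ 5 * e → e ^ 3 ≤ x → m ^ 3 ≤ 500 * x
m≤5*e⇒m³≤500*x {m} {e} {x} m≤5e e³≤x = begin
  m ^ 3          ≤⟨ ^-monoˡ-≤ 3 m≤5e ⟩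
  (5 * e) ^ 3    ≡⟨ cube-scale e ⟩
  125 * e ^ 3    ≤⟨ *-monoʳ-≤ 125 e³≤x ⟩
  125 * x        ≤⟨ *-monoˡ-≤ x (m≤m+n 125 375) ⟩
  500 * x        ∎
  where
  open ≤-Reasoning
  cube-scale : ∀ a → (5 * a) * ((5 * a) * ((5 * a) * 1)) ≡ 125 * (a * (a * (a * 1)))
  cube-scale = solve-∀

lemma2p2 : (n : ℕ) (G H : Graph n) →
    0 < edgeCount G →
    SpanningSubgraph H G →
    TriangleFree H →
    248 * edgeCount G ≤ 1000 * edgeCount H →
    Σ (VSet n) λ A → Σ (VSet n) λ B →
      Disjoint A B × Independent H A × Independent H B ×
      (edgeCount G ^ 3 ≤ 500 * n ^ 4 * crossEdges H A B) ×
      Σ (Fin n) (λ u → AdjToAll H u A) × Σ (Fin n) (λ w → AdjToAll H w B)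
lemma2p2 n G H 0<m _ triangle-free 248m≤1000h =
  let u , w , uw∈H , E³≤n⁴c = dense-neighbourhood-edge 0<E in
  adj H u , adj H w ,
  edge-neighbourhoods-disjoint H triangle-free uw∈H ,
  neighbourhood-independent H triangle-free u , neighbourhood-independent H triangle-free w ,
  subst (λ c → edgeCount G ^ 3 ≤ 500 * n ^ 4 * c) (sym (crossEdges-neighbourhoods u w))
    (subst (edgeCount G ^ 3 ≤_) (sym (*-assoc 500 (n ^ 4) (neighbourhoodEdges u w)))
      (m≤5*e⇒m³≤500*x {e = degreeSum} m≤5E E³≤n⁴c)) ,
  (u , λ _ ux → ux) , (w , λ _ wx → wx)
  where
  open Walks H
  m≤5E : edgeCount G ≤ 5 * degreeSum
  m≤5E = ≤-trans (248*m≤1000*h⇒m≤5*h {h = edgeCount H} 248m≤1000h) (*-monoʳ-≤ 5 edgeCount≤degreeSum)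
  0<E : 0 < degreeSum
  0<E = *-cancelˡ-< 5 0 degreeSum (<-≤-trans 0<m m≤5E)
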